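{- Work in Bishop-style constructive mathematics. For each fan $T$, the principle "every monotone $\Pi^0_1$ bar of $T$ is uniform" is equivalent to the principle "every c-bar of $T$ is uniform".
   Context: $\mathbb{N}^*$ is the set of finite sequences of natural numbers, $a*b$ concatenation, $\overline{\alpha}n$ the initial segment of length $n$ of $\alpha$. A tree is an inhabited decidable subset of $\mathbb{N}^*$ closed under initial segments. A spread is a tree $T$ with $\forall a\in T\,\exists n\,(a*\langle n\rangle\in T)$; a path of $T$ is $\alpha$ with $\forall n\,(\overline{\alpha}n\in T)$. A fan is a spread $T$ with $\forall a\in T\,\exists N\,\forall n\,[a*\langle n\rangle\in T\to n\le N]$. For a spread $T$, $P\subseteq T$ is a bar of $T$ if every path $\alpha$ of $T$ has some $n$ with $\overline{\alpha}n\in P$; a uniform bar (is uniform) if there is $N$ such that every path of $T$ has some $n\le N$ with $\overline{\alpha}n\in P$; $\Pi^0_1$ if $P=\bigcap_n B_n$ with each $B_n\subseteq T$ decidable; monotone if $a\in P$, $a*b\in T$ imply $a*b\in P$. A subset $P\subseteq T$ is a c-set if there is a decidable $D\subseteq\mathbb{N}^*$ with $P(a)\leftrightarrow\forall b\in\mathbb{N}^*\,(a*b\in D)$ for all $a\in T$; a c-bar of $T$ is a c-set that is a bar of $T$. -}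

module Defs where

open import Data.Nat using (ℕ; zero; suc; _≤_)
open import Data.List using (List; []; _∷_; _++_; [_])
open import Data.Product using (Σ; ∃; _×_; _,_)
open import Relation.Nullary using (Dec)

-- ℕ* = finite sequences of naturals, a * b = a ++ b, ⟨n⟩ = [ n ].

Subset : Set₁
Subset = List ℕ → Set

DecidableSubset : Subset → Set
DecidableSubset D = ∀ a → Dec (D a)

_⊆_ : Subset → Subset → Set
P ⊆ Q = ∀ a → P a → Q a

initSeg : (ℕ → ℕ) → ℕ → List ℕ
initSeg α zero = []
initSeg α (suc n) = initSeg α n ++ [ α n ]

record IsTree (T : Subset) : Set where
  field
    decidable : DecidableSubset T
    inhabited : ∃ λ a → T a
    closed    : ∀ a b → T (a ++ b) → T a

record IsSpread (T : Subset) : Set where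
  field
    tree   : IsTree T
    extend : ∀ a → T a → ∃ λ n → T (a ++ [ n ])

record IsFan (T : Subset) : Set where
  field
    spread  : IsSpread T
    bounded : ∀ a → T a → ∃ λ N → ∀ n → T (a ++ [ n ]) → n ≤ N

IsPath : Subset → (ℕ → ℕ) → Set
IsPath T α = ∀ n → T (initSeg α n)

IsBar : Subset → Subset → Set
IsBar T P = P ⊆ T × (∀ α → IsPath T α → ∃ λ n → P (initSeg α n))

IsUniform : Subset → Subset → Set
IsUniform T P = ∃ λ N → ∀ α → IsPath T α → ∃ λ n → n ≤ N × P (initSeg α n)

IsΠ⁰₁ : Subset → Subset → Set₁
IsΠ⁰₁ T P = Σ (ℕ → Subset) λ B →
  (∀ n → DecidableSubset (B n)) × (∀ n → B n ⊆ T) ×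
  (∀ a → (P a → ∀ n → B n a) × ((∀ n → B n a) → P a))

IsMonotone : Subset → Subset → Set
IsMonotone T P = ∀ a b → P a → T (a ++ b) → P (a ++ b)

IsCSet : Subset → Subset → Set₁
IsCSet T P = P ⊆ T × Σ Subset λ D → DecidableSubset D ×
  (∀ a → T a → (P a → ∀ b → D (a ++ b)) × ((∀ b → D (a ++ b)) → P a))

MonotoneΠ⁰₁BarsUniform : Subset → Set₁
MonotoneΠ⁰₁BarsUniform T =
  ∀ (P : Subset) → IsMonotone T P → IsΠ⁰₁ T P → IsBar T P → IsUniform T P

CBarsUniform : Subset → Set₁
CBarsUniform T = ∀ (P : Subset) → IsCSet T P → IsBar T P → IsUniform T P

module Submission where

-- Both principles speak about bars of T; we show that on a fan the two
-- classes of subsets coincide: every c-set is a monotone Π⁰₁ set, and every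
-- monotone Π⁰₁ set is a c-set.  Each principle then transfers to the other
-- class of bars verbatim.
--
-- c-set ⇒ monotone Π⁰₁.
-- For Π⁰₁ we approximate "∀ b, a * b ∈ D" by the decidable conditions
-- "a * b ∈ D for all b in the finite box (length ≤ n, entries ≤ n)"; every b
-- lies in some box, so the intersection of these conditions is the c-set.
--
-- monotone Π⁰₁ (P = ⋂ₙ Bₙ) ⇒ c-set.  The decidable set D follows a word c from
-- the root inside T; if c leaves T at a node u with r letters left, D demands
-- Bᵣ u.  For a ∈ T monotonicity gives P a ⇒ ∀ b, a * b ∈ D; conversely, since a
-- node of a fan has a child outside T, leaving T right at a with any number n
-- of letters left shows Bₙ a for every n.  This direction only needs a
-- decidable tree in which every node has a child outside the tree.

open import Defs
open import Data.Product using (_×_; _,_; proj₁; proj₂; ∃)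
open import Data.Nat using (ℕ; zero; suc; _+_; _≤_; _<_; s≤s)
open import Data.Nat.Properties using (≤-trans; m≤m+n; m≤n+m; allUpTo?; n≮n)
open import Data.Nat.ListAction using (sum)
open import Data.List using (List; []; _∷_; _++_; [_]; length; replicate)
open import Data.List.Properties using (++-assoc; ++-identityʳ; length-replicate)
open import Data.List.Relation.Unary.All as All using (All; []; _∷_)
open import Data.Bool using (if_then_else_)
open import Relation.Nullary using (Dec; yes; no; does; ¬_)
open import Relation.Nullary.Decidable using (_×-dec_)
open import Relation.Binary.PropositionalEquality
  using (_≡_; sym; trans; cong; subst)
open import Data.Unit using (⊤; tt)
open import Data.Empty using (⊥-elim)

Box : ℕ → ℕ → Subset → Set
Box n zero    Q = Q []
Box n (suc k) Q = Q [] × (∀ {i} → i < suc n → Box n k (λ b → Q (i ∷ b)))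

box? : ∀ n k (Q : Subset) → DecidableSubset Q → Dec (Box n k Q)
box? n zero    Q Q? = Q? []
box? n (suc k) Q Q? =
  Q? [] ×-dec allUpTo? (λ i → box? n k (λ b → Q (i ∷ b)) (λ b → Q? (i ∷ b))) (suc n)

box-intro : ∀ n k (Q : Subset) → (∀ b → Q b) → Box n k Q
box-intro n zero    Q h = h []
box-intro n (suc k) Q h = h [] , λ _ → box-intro n k _ (λ b → h (_ ∷ b))

box-elim : ∀ n k (Q : Subset) → Box n k Q →
           ∀ b → length b ≤ k → All (_≤ n) b → Q b
box-elim n zero    Q q       []      _       _          = q
box-elim n (suc k) Q (q , _) []      _       _          = q
box-elim n (suc k) Q (_ , f) (i ∷ b) (s≤s l) (i≤n ∷ ps) =
  box-elim n k _ (f (s≤s i≤n)) b l ps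

-- Every word b lies in the box of size sum b + length b.
size : List ℕ → ℕ
size b = sum b + length b

entries≤sum : ∀ b → All (_≤ sum b) b
entries≤sum []      = []
entries≤sum (x ∷ b) =
  m≤m+n x (sum b) ∷ All.map (λ p → ≤-trans p (m≤n+m (sum b) x)) (entries≤sum b)

length≤size : ∀ b → length b ≤ size b
length≤size b = m≤n+m (length b) (sum b)

entries≤size : ∀ b → All (_≤ size b) b
entries≤size b = All.map (λ p → ≤-trans p (m≤m+n (sum b) (length b))) (entries≤sum b)

cSet⇒monotone : ∀ {T P} → IsCSet T P → IsMonotone T P
cSet⇒monotone {T} {P} (P⊆T , D , _ , iff) a b Pa Tab =
  proj₂ (iff (a ++ b) Tab) λ c →
    subst D (sym (++-assoc a b c)) (proj₁ (iff a (P⊆T a Pa)) Pa (b ++ c))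

cSet⇒Π⁰₁ : ∀ {T P} → DecidableSubset T → IsCSet T P → IsΠ⁰₁ T P
cSet⇒Π⁰₁ {T} {P} T? (P⊆T , D , D? , iff) = B , B? , (λ _ _ → proj₁) , P⇔⋂B
  where
  B : ℕ → Subset
  B n a = T a × Box n n (λ b → D (a ++ b))

  B? : ∀ n → DecidableSubset (B n)
  B? n a = T? a ×-dec box? n n _ (λ b → D? (a ++ b))

  P⇔⋂B : ∀ a → (P a → ∀ n → B n a) × ((∀ n → B n a) → P a)
  P⇔⋂B a = (λ Pa n → P⊆T a Pa , box-intro n n _ (proj₁ (iff a (P⊆T a Pa)) Pa))
         , λ h → proj₂ (iff a (proj₁ (h 0))) λ b →
             box-elim (size b) (size b) _ (proj₂ (h (size b))) b
                      (length≤size b) (entries≤size b)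

HasExits : Subset → Set
HasExits T = ∀ a → T a → ∃ λ y → ¬ T (a ++ [ y ])

fan⇒hasExits : ∀ {T} → IsFan T → HasExits T
fan⇒hasExits F a Ta with IsFan.bounded F a Ta
... | N , bounded = suc N , λ T-child → n≮n N (bounded (suc N) T-child)

module ExitTest (T : Subset) (T? : DecidableSubset T)
                (closed : ∀ a b → T (a ++ b) → T a)
                (B : ℕ → Subset) (B? : ∀ n → DecidableSubset (B n)) where

  Exit : List ℕ → List ℕ → Set
  Exit x []      = ⊤
  Exit x (y ∷ r) =
    if does (T? (x ++ [ y ])) then Exit (x ++ [ y ]) r else B (length r) x

  exit? : ∀ x c → Dec (Exit x c)
  exit? x []      = yes tt
  exit? x (y ∷ r) with T? (x ++ [ y ])
  ... | yes _ = exit? (x ++ [ y ]) r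
  ... | no  _ = B? (length r) x

  exit-++ : ∀ x a b → T (x ++ a) → Exit x (a ++ b) ≡ Exit (x ++ a) b
  exit-++ x []      b _   = cong (λ z → Exit z b) (sym (++-identityʳ x))
  exit-++ x (y ∷ a) b Txya with T? (x ++ [ y ])
  ... | yes _ = trans (exit-++ (x ++ [ y ]) a b Txy++a)
                      (cong (λ z → Exit z b) (++-assoc x [ y ] a))
    where
    Txy++a : T ((x ++ [ y ]) ++ a)
    Txy++a = subst T (sym (++-assoc x [ y ] a)) Txya
  ... | no ¬Txy = ⊥-elim (¬Txy (closed (x ++ [ y ]) a
                                  (subst T (sym (++-assoc x [ y ] a)) Txya)))

monotoneΠ⁰₁⇒cSet : ∀ {T P} → IsTree T → HasExits T →
                   IsMonotone T P → IsΠ⁰₁ T P → IsCSet T P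
monotoneΠ⁰₁⇒cSet {T} {P} tree exits mono (B , B? , B⊆T , iff) =
  P⊆T , Exit [] , exit? [] , λ a Ta →
    (λ Pa b → subst (λ X → X) (sym (exit-++ [] a b Ta)) (P⇒exit a Pa b)) ,
    (λ h → exit⇒P a Ta (λ b → subst (λ X → X) (exit-++ [] a b Ta) (h b)))
  where
  open ExitTest T (IsTree.decidable tree) (IsTree.closed tree) B B?

  P⊆T : P ⊆ T
  P⊆T a Pa = B⊆T 0 a (proj₁ (iff a) Pa 0)

  P⇒exit : ∀ x → P x → ∀ c → Exit x c
  P⇒exit x Px []      = tt
  P⇒exit x Px (y ∷ r) with IsTree.decidable tree (x ++ [ y ])
  ... | yes Txy = P⇒exit (x ++ [ y ]) (mono x [ y ] Px Txy) r
  ... | no  _   = proj₁ (iff x) Px (length r)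

  exit⇒P : ∀ x → T x → (∀ c → Exit x c) → P x
  exit⇒P x Tx h = proj₂ (iff x) B-at-x
    where
    B-at-x : ∀ n → B n x
    B-at-x n with exits x Tx
    ... | y , ¬Txy with h (y ∷ replicate n 0)
    ... | exit with IsTree.decidable tree (x ++ [ y ])
    ... | yes Txy = ⊥-elim (¬Txy Txy)
    ... | no  _   = subst (λ m → B m x) (length-replicate n) exit

proposition3p3 : ∀ (T : Subset) → IsFan T → (MonotoneΠ⁰₁BarsUniform T → CBarsUniform T) × (CBarsUniform T → MonotoneΠ⁰₁BarsUniform T)
proposition3p3 T F =
  (λ monotoneUniform P cSet bar →
     monotoneUniform P (cSet⇒monotone cSet) (cSet⇒Π⁰₁ (IsTree.decidable tree) cSet) bar) ,
  (λ cUniform P mono Π⁰₁ bar →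
     cUniform P (monotoneΠ⁰₁⇒cSet tree (fan⇒hasExits F) mono Π⁰₁) bar)
  where
  tree : IsTree T
  tree = IsSpread.tree (IsFan.spread F)
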